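{- Let $J_3:\mathbb{N}\to\mathbb{N}$ be the Josephus function with reduction constant $3$, and let $\{n_e^{(i)}\}_{i\in\mathbb{N}}$ be the strictly increasing enumeration of all high extremal points of $J_3$ (so $n_e^{(1)}=1$). For each $i$ define $r_i:=n_e^{(i)}\bmod 2$, $f_i:=n_e^{(i)}-J_3(n_e^{(i)})$, and $s_i:=\left(\frac{3n_e^{(i)}+2-r_i}{2}\right)\bmod 2$. Then for all $i\in\mathbb{N}$: \[ n_e^{(i+1)}=\frac{3n_e^{(i)}+1+(1-r_i)(2f_i-1)}{2},\qquad J_3(n_e^{(i+1)})=\frac{3n_e^{(i)}+(2-3r_i)(2f_i-1)}{2}, \] \[ f_{i+1}=f_i-(1-r_i)(2f_i-1),\qquad r_{i+1}=s_i-(1-r_i)(1-f_i)(2s_i-1). \]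
   Context: The Josephus function $J_3$: for $n\in\mathbb{N}=\{1,2,\dots\}$, place $n$ people numbered $1,\dots,n$ clockwise in a circle; starting the count at person $1$ and proceeding clockwise, eliminate every third person (the first eliminated is person $3$), the circle closing ranks after each elimination, until one person remains; $J_3(n)$ is the original number of the survivor. Equivalently $J_3(1)=1$ and $J_3(n)=((J_3(n-1)+2)\bmod n)+1$ for $n\ge 2$. A positive integer $n$ is a high extremal point of $J_3$ if $J_3(n)\in\{n-1,n\}$. -}

module Defs where

open import Data.Nat using (ℕ; zero; suc; _+_; _*_; _∸_; _≤_; _<_)
open import Data.Nat.DivMod using (_%_; _/_)
open import Data.Product using (_×_; ∃)
open import Data.Sum using (_⊎_)
open import Relation.Binary.PropositionalEquality using (_≡_)
open import Function.Bundles using (_⇔_)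
open import Data.Integer as ℤ using (ℤ; +_)

-- Josephus function with reduction constant 3, via the recurrence
-- J3(1) = 1, J3(n) = ((J3(n-1) + 2) mod n) + 1 for n ≥ 2.
-- J3 0 = 0 is a junk value (0 ∉ ℕ = {1,2,...} in the paper).
J3 : ℕ → ℕ
J3 zero = zero
J3 (suc zero) = 1
J3 (suc (suc k)) = ((J3 (suc k) + 2) % suc (suc k)) + 1

HighExtremal : ℕ → Set
HighExtremal n = 1 ≤ n × (J3 n ≡ n ∸ 1 ⊎ J3 n ≡ n)

-- e is the strictly increasing enumeration of all high extremal points
-- (indexed from 0 here: e 0 = n_e^(1), e i = n_e^(i+1)).
IsHighExtremalEnum : (ℕ → ℕ) → Set
IsHighExtremalEnum e =
  (∀ i → e i < e (suc i)) × (∀ n → HighExtremal n ⇔ ∃ λ i → e i ≡ n)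

rOf : ℕ → ℕ
rOf n = n % 2

fOf : ℕ → ℤ
fOf n = + n ℤ.- + J3 n

-- s(n) = ((3n + 2 - r(n)) / 2) mod 2   (numerator is always even)
sOf : ℕ → ℕ
sOf n = ((3 * n + 2 ∸ rOf n) / 2) % 2

-- Let a be a high extremal point with defect f = a - J3 a ∈ {0, 1}.  Then J3 (a + 1) = c
-- with c = 2 - f, and as long as c + 2k ≤ a + 1 the recurrence never wraps around, so
-- J3 (a + 1 + k) = c + 3k: the gap n - J3 n shrinks by 2 at each step.  The next high
-- extremal point is therefore a + 1 + k for the k with c + 2k ∈ {a, a + 1}, and its defect
-- is a + 1 - (c + 2k).  Splitting by the parity of a and by f gives four explicit cases,
-- in each of which the four identities are polynomial identities in a / 2.

module Submission where

open import Defs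
open import Data.Nat using (ℕ; suc)
open import Data.Product using (_×_)
open import Relation.Binary.PropositionalEquality using (_≡_)
open import Data.Integer using (ℤ; +_; _+_; _-_; _*_)

open import Data.Nat as ℕ using (zero; z≤n; s≤s; _≤_; _<_; _≤′_; ≤′-refl; ≤′-step; _∸_)
open import Data.Nat.Properties
  using (≤-refl; ≤-reflexive; ≤-trans; <⇒≤; <⇒≱; <-cmp; ≤⇒≤′; n≤1+n; m≤m+n; m≤n+m; suc-injective;
         +-suc; +-comm; +-assoc; +-identityʳ; *-comm; +-monoʳ-≤; +-monoˡ-≤; *-monoʳ-≤; +-cancelˡ-<;
         m+[n∸m]≡n; m+n∸m≡n)
open import Data.Nat.DivMod using (_%_; _/_; [m+kn]%n≡m%n; [m+n]%n≡m%n; n%n≡0; m<n⇒m%n≡m; m*n/n≡m)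
open import Data.Product using (_,_; ∃)
open import Data.Sum using (inj₁; inj₂)
open import Function using (_∘_)
open import Function.Bundles using (_⇔_; Equivalence)
open import Relation.Nullary using (¬_)
open import Relation.Nullary.Negation using (contradiction)
open import Relation.Binary.Definitions using (tri<; tri≈; tri>)
open import Relation.Binary.PropositionalEquality using (refl; sym; trans; cong; cong₂; subst; module ≡-Reasoning)
open import Data.List using ([]; _∷_)
import Data.Nat.Tactic.RingSolver as ℕ-Solver
import Data.Integer.Tactic.RingSolver as ℤ-Solver

IsNext : (ℕ → Set) → ℕ → ℕ → Set
IsNext P a b = a < b × P b × (∀ {m} → a < m → m < b → ¬ P m)

IsNext-unique : ∀ {P a b b′} → IsNext P a b → IsNext P a b′ → b ≡ b′
IsNext-unique {b = b} {b′} (a<b , Pb , gap) (a<b′ , Pb′ , gap′) with <-cmp b b′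
... | tri< b<b′ _ _ = contradiction Pb (gap′ a<b b<b′)
... | tri≈ _ b≡b′ _ = b≡b′
... | tri> _ _ b′<b = contradiction Pb′ (gap a<b′ b′<b)

module Enumeration {P : ℕ → Set} {e : ℕ → ℕ}
  (e-increasing : ∀ i → e i < e (suc i))
  (e-enumerates : ∀ n → P n ⇔ ∃ λ i → e i ≡ n) where

  e-mono : ∀ {i j} → i ≤ j → e i ≤ e j
  e-mono = go ∘ ≤⇒≤′
    where
    go : ∀ {i j} → i ≤′ j → e i ≤ e j
    go ≤′-refl = ≤-refl
    go (≤′-step i≤′j) = ≤-trans (go i≤′j) (<⇒≤ (e-increasing _))

  P-at : ∀ i → P (e i)
  P-at i = Equivalence.from (e-enumerates (e i)) (i , refl)

  next-in-enumeration : ∀ i → IsNext P (e i) (e (suc i))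
  next-in-enumeration i = e-increasing i , P-at (suc i) , gap
    where
    gap : ∀ {m} → e i < m → m < e (suc i) → ¬ P m
    gap ei<m m<ei+1 Pm with Equivalence.to (e-enumerates _) Pm
    ... | j , refl with <-cmp i j
    ...   | tri< i<j _ _ = <⇒≱ m<ei+1 (e-mono i<j)
    ...   | tri≈ _ refl _ = <⇒≱ ei<m ≤-refl
    ...   | tri> _ _ j<i = <⇒≱ ei<m (e-mono (<⇒≤ j<i))

J3≡pred⇒J3[suc]≡1 : ∀ n → J3 (suc n) ≡ n → J3 (2 ℕ.+ n) ≡ 1
J3≡pred⇒J3[suc]≡1 n J≡n = begin
  (J3 (suc n) ℕ.+ 2) % (2 ℕ.+ n) ℕ.+ 1  ≡⟨ cong (λ j → (j ℕ.+ 2) % (2 ℕ.+ n) ℕ.+ 1) J≡n ⟩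
  (n ℕ.+ 2) % (2 ℕ.+ n) ℕ.+ 1          ≡⟨ cong (λ m → m % (2 ℕ.+ n) ℕ.+ 1) (+-comm n 2) ⟩
  (2 ℕ.+ n) % (2 ℕ.+ n) ℕ.+ 1          ≡⟨ cong (ℕ._+ 1) (n%n≡0 (2 ℕ.+ n)) ⟩
  1                                     ∎
  where open ≡-Reasoning

J3≡id⇒J3[suc]≡2 : ∀ n → J3 (suc n) ≡ suc n → J3 (2 ℕ.+ n) ≡ 2
J3≡id⇒J3[suc]≡2 n J≡n = begin
  (J3 (suc n) ℕ.+ 2) % (2 ℕ.+ n) ℕ.+ 1  ≡⟨ cong (λ j → (j ℕ.+ 2) % (2 ℕ.+ n) ℕ.+ 1) J≡n ⟩
  (1 ℕ.+ (n ℕ.+ 2)) % (2 ℕ.+ n) ℕ.+ 1  ≡⟨ cong (λ m → (1 ℕ.+ m) % (2 ℕ.+ n) ℕ.+ 1) (+-comm n 2) ⟩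
  (1 ℕ.+ (2 ℕ.+ n)) % (2 ℕ.+ n) ℕ.+ 1  ≡⟨ cong (ℕ._+ 1) ([m+n]%n≡m%n 1 (2 ℕ.+ n)) ⟩
  2                                     ∎
  where open ≡-Reasoning

J3-linear : ∀ {n c} k → J3 (suc n) ≡ c → c ℕ.+ 2 ℕ.* k ≤ suc n → J3 (suc n ℕ.+ k) ≡ c ℕ.+ 3 ℕ.* k
J3-linear {n} {c} zero J≡c _ = trans (cong J3 (+-identityʳ (suc n))) (trans J≡c (sym (+-identityʳ c)))
J3-linear {n} {c} (suc k) J≡c bound = begin
  J3 (suc n ℕ.+ suc k)                            ≡⟨ cong J3 (+-suc (suc n) k) ⟩
  (J3 (suc n ℕ.+ k) ℕ.+ 2) % (2 ℕ.+ n ℕ.+ k) ℕ.+ 1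
    ≡⟨ cong (λ j → (j ℕ.+ 2) % (2 ℕ.+ n ℕ.+ k) ℕ.+ 1) (J3-linear k J≡c bound′) ⟩
  (c ℕ.+ 3 ℕ.* k ℕ.+ 2) % (2 ℕ.+ n ℕ.+ k) ℕ.+ 1    ≡⟨ cong (ℕ._+ 1) (m<n⇒m%n≡m no-wrap) ⟩
  c ℕ.+ 3 ℕ.* k ℕ.+ 2 ℕ.+ 1                       ≡⟨ ℕ-Solver.solve (c ∷ k ∷ []) ⟩
  c ℕ.+ 3 ℕ.* suc k                               ∎
  where
  open ≡-Reasoning
  bound′ : c ℕ.+ 2 ℕ.* k ≤ suc n
  bound′ = ≤-trans (+-monoʳ-≤ c (*-monoʳ-≤ 2 (n≤1+n k))) bound
  no-wrap : c ℕ.+ 3 ℕ.* k ℕ.+ 2 < 2 ℕ.+ n ℕ.+ k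
  no-wrap = s≤s (subst (_≤ suc n ℕ.+ k) regroup (+-monoˡ-≤ k bound))
    where
    regroup : c ℕ.+ 2 ℕ.* suc k ℕ.+ k ≡ c ℕ.+ 3 ℕ.* k ℕ.+ 2
    regroup = ℕ-Solver.solve (c ∷ k ∷ [])

HighExtremal⇒≤1+J3 : ∀ {m} → HighExtremal m → m ≤ suc (J3 m)
HighExtremal⇒≤1+J3 (s≤s z≤n , inj₁ J≡m∸1) = s≤s (≤-reflexive (sym J≡m∸1))
HighExtremal⇒≤1+J3 (_ , inj₂ J≡m) = ≤-trans (≤-reflexive (sym J≡m)) (n≤1+n _)

1+J3<⇒¬HighExtremal : ∀ {m} → suc (J3 m) < m → ¬ HighExtremal m
1+J3<⇒¬HighExtremal 1+J<m high = <⇒≱ 1+J<m (HighExtremal⇒≤1+J3 high)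

HighExtremal-intro : ∀ {n} t → t ≤ 1 → t ℕ.+ J3 (suc n) ≡ suc n → HighExtremal (suc n)
HighExtremal-intro _ z≤n J≡n = s≤s z≤n , inj₂ J≡n
HighExtremal-intro _ (s≤s z≤n) 1+J≡1+n = s≤s z≤n , inj₁ (suc-injective 1+J≡1+n)

J3-linear⇒¬HighExtremal : ∀ {n c k j} → J3 (suc n) ≡ c → c ℕ.+ 2 ℕ.* k ≤ suc n → j < k →
  ¬ HighExtremal (suc n ℕ.+ j)
J3-linear⇒¬HighExtremal {n} {c} {k} {j} J≡c bound j<k =
  1+J3<⇒¬HighExtremal (subst (λ x → suc x < suc n ℕ.+ j) (sym J≡) below)
  where
  bound′ : c ℕ.+ 2 ℕ.* suc j ≤ suc n
  bound′ = ≤-trans (+-monoʳ-≤ c (*-monoʳ-≤ 2 j<k)) bound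
  J≡ : J3 (suc n ℕ.+ j) ≡ c ℕ.+ 3 ℕ.* j
  J≡ = J3-linear j J≡c (≤-trans (+-monoʳ-≤ c (*-monoʳ-≤ 2 (n≤1+n j))) bound′)
  regroup : c ℕ.+ 2 ℕ.* suc j ℕ.+ j ≡ 2 ℕ.+ (c ℕ.+ 3 ℕ.* j)
  regroup = ℕ-Solver.solve (c ∷ j ∷ [])
  below : suc (c ℕ.+ 3 ℕ.* j) < suc n ℕ.+ j
  below = subst (_≤ suc n ℕ.+ j) regroup (+-monoˡ-≤ j bound′)

next-high-extremal : ∀ {a c k} t → t ≤ 1 → J3 (suc a) ≡ c → t ℕ.+ (c ℕ.+ (k ℕ.+ k)) ≡ suc a →
  IsNext HighExtremal a (suc a ℕ.+ k) × J3 (suc a ℕ.+ k) ≡ c ℕ.+ (k ℕ.+ k) ℕ.+ k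
next-high-extremal {a} {c} {k} t t≤1 J≡c catch-up = (s≤s (m≤m+n a k) , high , gap) , J≡
  where
  bound : c ℕ.+ 2 ℕ.* k ≤ suc a
  bound = subst (λ x → c ℕ.+ (k ℕ.+ x) ≤ suc a) (sym (+-identityʳ k))
                (subst (c ℕ.+ (k ℕ.+ k) ≤_) catch-up (m≤n+m _ t))
  regroup : c ℕ.+ 3 ℕ.* k ≡ c ℕ.+ (k ℕ.+ k) ℕ.+ k
  regroup = ℕ-Solver.solve (c ∷ k ∷ [])
  J≡ : J3 (suc a ℕ.+ k) ≡ c ℕ.+ (k ℕ.+ k) ℕ.+ k
  J≡ = trans (J3-linear k J≡c bound) regroup
  high : HighExtremal (suc a ℕ.+ k)
  high = HighExtremal-intro t t≤1 (begin
    t ℕ.+ J3 (suc a ℕ.+ k)              ≡⟨ cong (t ℕ.+_) J≡ ⟩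
    t ℕ.+ (c ℕ.+ (k ℕ.+ k) ℕ.+ k)       ≡⟨ sym (+-assoc t _ k) ⟩
    t ℕ.+ (c ℕ.+ (k ℕ.+ k)) ℕ.+ k       ≡⟨ cong (ℕ._+ k) catch-up ⟩
    suc a ℕ.+ k                         ∎)
    where open ≡-Reasoning
  gap : ∀ {m} → a < m → m < suc a ℕ.+ k → ¬ HighExtremal m
  gap {m} a<m m<b = subst (¬_ ∘ HighExtremal) (m+[n∸m]≡n a<m)
    (J3-linear⇒¬HighExtremal J≡c bound
      (+-cancelˡ-< (suc a) _ _ (subst (_< suc a ℕ.+ k) (sym (m+[n∸m]≡n a<m)) m<b)))

-- Written with q + q rather than 2 * q because +_ : ℕ → ℤ commutes with ℕ-addition
-- definitionally, so that the case identities below are ring identities in + q.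
data OddOrEven : ℕ → Set where
  odd  : ∀ q → OddOrEven (1 ℕ.+ (q ℕ.+ q))
  even : ∀ q → OddOrEven (2 ℕ.+ (q ℕ.+ q))

odd-or-even : ∀ n → OddOrEven (suc n)
odd-or-even zero = odd 0
odd-or-even (suc n) with odd-or-even n
... | odd q  = even q
... | even q = subst OddOrEven (cong (2 ℕ.+_) (+-suc q q)) (odd (suc q))

[m+[q+q]]%2≡m%2 : ∀ m q → (m ℕ.+ (q ℕ.+ q)) % 2 ≡ m % 2
[m+[q+q]]%2≡m%2 m q = trans (cong (λ x → (m ℕ.+ x) % 2) (sym q*2≡q+q)) ([m+kn]%n≡m%n m q 2)
  where
  q*2≡q+q : q ℕ.* 2 ≡ q ℕ.+ q
  q*2≡q+q = trans (*-comm q 2) (cong (q ℕ.+_) (+-identityʳ q))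

rOf-odd : ∀ q → rOf (1 ℕ.+ (q ℕ.+ q)) ≡ 1
rOf-odd = [m+[q+q]]%2≡m%2 1

rOf-even : ∀ q → rOf (2 ℕ.+ (q ℕ.+ q)) ≡ 0
rOf-even = [m+[q+q]]%2≡m%2 2

+[n%2]≡1-+[1+n]%2 : ∀ n → + (n % 2) ≡ + 1 - + (suc n % 2)
+[n%2]≡1-+[1+n]%2 zero = refl
+[n%2]≡1-+[1+n]%2 (suc zero) = refl
+[n%2]≡1-+[1+n]%2 (suc (suc n)) = +[n%2]≡1-+[1+n]%2 n

sOf≡ : ∀ a {r} w → rOf a ≡ r → 3 ℕ.* a ℕ.+ 2 ≡ r ℕ.+ w ℕ.* 2 → sOf a ≡ w % 2
sOf≡ a {r} w r≡ eq = begin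
  ((3 ℕ.* a ℕ.+ 2 ∸ rOf a) / 2) % 2 ≡⟨ cong₂ (λ x y → ((x ∸ y) / 2) % 2) eq r≡ ⟩
  ((r ℕ.+ w ℕ.* 2 ∸ r) / 2) % 2     ≡⟨ cong (λ x → (x / 2) % 2) (m+n∸m≡n r (w ℕ.* 2)) ⟩
  (w ℕ.* 2 / 2) % 2                 ≡⟨ cong (_% 2) (m*n/n≡m w 2) ⟩
  w % 2                             ∎
  where open ≡-Reasoning

sOf-odd : ∀ q → sOf (1 ℕ.+ (q ℕ.+ q)) ≡ (2 ℕ.+ (q ℕ.+ q) ℕ.+ q) % 2
sOf-odd q = sOf≡ (1 ℕ.+ (q ℕ.+ q)) (2 ℕ.+ (q ℕ.+ q) ℕ.+ q) (rOf-odd q) halving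
  where
  halving : 3 ℕ.* (1 ℕ.+ (q ℕ.+ q)) ℕ.+ 2 ≡ 1 ℕ.+ (2 ℕ.+ (q ℕ.+ q) ℕ.+ q) ℕ.* 2
  halving = ℕ-Solver.solve (q ∷ [])

sOf-even : ∀ q → sOf (2 ℕ.+ (q ℕ.+ q)) ≡ (4 ℕ.+ (q ℕ.+ q) ℕ.+ q) % 2
sOf-even q = sOf≡ (2 ℕ.+ (q ℕ.+ q)) (4 ℕ.+ (q ℕ.+ q) ℕ.+ q) (rOf-even q) halving
  where
  halving : 3 ℕ.* (2 ℕ.+ (q ℕ.+ q)) ℕ.+ 2 ≡ 0 ℕ.+ (4 ℕ.+ (q ℕ.+ q) ℕ.+ q) ℕ.* 2
  halving = ℕ-Solver.solve (q ∷ [])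

Recurrence : (a ja b jb r r′ s : ℤ) → Set
Recurrence a ja b jb r r′ s =
    (+ 2 * b ≡ + 3 * a + + 1 + (+ 1 - r) * (+ 2 * (a - ja) - + 1))
  × (+ 2 * jb ≡ + 3 * a + (+ 2 - + 3 * r) * (+ 2 * (a - ja) - + 1))
  × (b - jb ≡ (a - ja) - (+ 1 - r) * (+ 2 * (a - ja) - + 1))
  × (r′ ≡ s - (+ 1 - r) * (+ 1 - (a - ja)) * (+ 2 * s - + 1))

RecurrenceBetween : ℕ → ℕ → Set
RecurrenceBetween a b = Recurrence (+ a) (+ J3 a) (+ b) (+ J3 b) (+ rOf a) (+ rOf b) (+ sOf a)

recurrence-odd-pred : ∀ p σ →
  Recurrence (+ 1 + (p + p)) (p + p) (+ 2 + (p + p) + p) (+ 1 + (p + p) + p) (+ 1) σ σ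
recurrence-odd-pred p σ =
    ℤ-Solver.solve (p ∷ σ ∷ []) , ℤ-Solver.solve (p ∷ σ ∷ [])
  , ℤ-Solver.solve (p ∷ σ ∷ []) , ℤ-Solver.solve (p ∷ σ ∷ [])

recurrence-odd-fixed : ∀ p σ →
  Recurrence (+ 1 + (p + p)) (+ 1 + (p + p)) (+ 2 + (p + p) + p) (+ 2 + (p + p) + p) (+ 1) σ σ
recurrence-odd-fixed p σ =
    ℤ-Solver.solve (p ∷ σ ∷ []) , ℤ-Solver.solve (p ∷ σ ∷ [])
  , ℤ-Solver.solve (p ∷ σ ∷ []) , ℤ-Solver.solve (p ∷ σ ∷ [])

recurrence-even-pred : ∀ p σ →
  Recurrence (+ 2 + (p + p)) (+ 1 + (p + p)) (+ 3 + (p + p) + (+ 1 + p))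
             (+ 1 + ((+ 1 + p) + (+ 1 + p)) + (+ 1 + p)) (+ 0) σ σ
recurrence-even-pred p σ =
    ℤ-Solver.solve (p ∷ σ ∷ []) , ℤ-Solver.solve (p ∷ σ ∷ [])
  , ℤ-Solver.solve (p ∷ σ ∷ []) , ℤ-Solver.solve (p ∷ σ ∷ [])

recurrence-even-fixed : ∀ p σ →
  Recurrence (+ 2 + (p + p)) (+ 2 + (p + p)) (+ 3 + (p + p) + p) (+ 2 + (p + p) + p) (+ 0) (+ 1 - σ) σ
recurrence-even-fixed p σ =
    ℤ-Solver.solve (p ∷ σ ∷ []) , ℤ-Solver.solve (p ∷ σ ∷ [])
  , ℤ-Solver.solve (p ∷ σ ∷ []) , ℤ-Solver.solve (p ∷ σ ∷ [])

recurrence-from : ∀ {a b b₀ ja jb r s r′} → IsNext HighExtremal a b →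
  IsNext HighExtremal a b₀ × J3 b₀ ≡ jb → J3 a ≡ ja → rOf a ≡ r → sOf a ≡ s → + rOf b₀ ≡ r′ →
  Recurrence (+ a) (+ ja) (+ b₀) (+ jb) (+ r) r′ (+ s) → RecurrenceBetween a b
recurrence-from next (next₀ , refl) refl refl refl refl R rewrite IsNext-unique next next₀ = R

recurrence : ∀ {a b} → HighExtremal a → IsNext HighExtremal a b → RecurrenceBetween a b
recurrence {suc n} (_ , J≡) next with odd-or-even n | J≡
... | odd q | inj₁ J≡a∸1 =
  recurrence-from next
    (next-high-extremal {k = q} 1 (s≤s z≤n) (J3≡pred⇒J3[suc]≡1 _ J≡a∸1) refl)
    J≡a∸1 (rOf-odd q) (sOf-odd q) refl (recurrence-odd-pred (+ q) _)
... | odd q | inj₂ J≡a =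
  recurrence-from next
    (next-high-extremal {k = q} 0 z≤n (J3≡id⇒J3[suc]≡2 _ J≡a) refl)
    J≡a (rOf-odd q) (sOf-odd q) refl (recurrence-odd-fixed (+ q) _)
... | even q | inj₁ J≡a∸1 =
  recurrence-from next
    (next-high-extremal {k = suc q} 0 z≤n (J3≡pred⇒J3[suc]≡1 _ J≡a∸1) (cong (2 ℕ.+_) (+-suc q q)))
    J≡a∸1 (rOf-even q) (sOf-even q) (cong (λ m → + ((3 ℕ.+ m) % 2)) (+-suc (q ℕ.+ q) q))
    (recurrence-even-pred (+ q) _)
... | even q | inj₂ J≡a =
  recurrence-from next
    (next-high-extremal {k = q} 1 (s≤s z≤n) (J3≡id⇒J3[suc]≡2 _ J≡a) refl)
    J≡a (rOf-even q) (sOf-even q) (+[n%2]≡1-+[1+n]%2 (3 ℕ.+ (q ℕ.+ q) ℕ.+ q))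
    (recurrence-even-fixed (+ q) (+ ((4 ℕ.+ (q ℕ.+ q) ℕ.+ q) % 2)))

lemma2 : (e : ℕ → ℕ) → IsHighExtremalEnum e → (i : ℕ) →
    (+ 2 * + e (suc i) ≡ + 3 * + e i + + 1 + (+ 1 - + rOf (e i)) * (+ 2 * fOf (e i) - + 1))
    × (+ 2 * + J3 (e (suc i)) ≡ + 3 * + e i + (+ 2 - + 3 * + rOf (e i)) * (+ 2 * fOf (e i) - + 1))
    × (fOf (e (suc i)) ≡ fOf (e i) - (+ 1 - + rOf (e i)) * (+ 2 * fOf (e i) - + 1))
    × (+ rOf (e (suc i)) ≡ + sOf (e i) - (+ 1 - + rOf (e i)) * (+ 1 - fOf (e i)) * (+ 2 * + sOf (e i) - + 1))
lemma2 e (increasing , enumerates) i = recurrence (P-at i) (next-in-enumeration i)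
  where open Enumeration increasing enumerates
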